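{- Let $\succsim$ be a quasi-precedence and $\sigma$ a status, and let $\mathcal A_{\max}$ be the algebra induced by a weight function $(w,w_0)$ and a subterm penalty function $p$. If $w_0=0$, $w(f)=0$ and $p(f,i)=0$ for all $f\in\Sigma_n$ and $i\in\{1,\dots,n\}$, then $\succ_{\mathrm{LPO}}=\succ_{\mathrm{WPO}(\mathcal A_{\max})}$, both induced by $\succsim$ and $\sigma$.
   Context: Terms over a finite signature $\Sigma$ and variables $\mathcal V$. A quasi-precedence $\succsim$ is a quasi-order on $\Sigma$ with well-founded strict part $\succ$ and equivalence $\sim$. A status $\sigma$ maps $f\in\Sigma_n$ to a permutation $[i_1..i_n]$ of $\{1..n\}$; $\sigma(f)(s_1..s_n)=[s_{i_1},\dots,s_{i_n}]$. For strict $\succ$ with reflexive closure $\succeq$: $[s_1..s_n]\succ^{\mathrm{lex}}[t_1..t_m]$ iff there is $k<n$ with $s_i\succeq t_i$ for $i\le k$ and either $k=m$, or $k<m$ and $s_{k+1}\succ t_{k+1}$. LPO: no variable is greater than any term; $s=f(s_1..s_n)\succ_{\mathrm{LPO}}t$ iff (a) $s_i\succeq_{\mathrm{LPO}}t$ for some $i$, or (b) $t=g(t_1..t_m)$, $s\succ_{\mathrm{LPO}}t_j$ for all $j$, and either $f\succ g$, or $f\sim g$ and $\sigma(f)(s_1..s_n)\succ_{\mathrm{LPO}}^{\mathrm{lex}}\sigma(g)(t_1..t_m)$. A weight function $(w,w_0)$: $w:\Sigma\to\mathbb N$, $w_0\in\mathbb N$, $w(c)\ge w_0$ for constants. A subterm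 penalty function gives $p(f,i)\in\mathbb N$ for $f\in\Sigma_n$, $1\le i\le n$. $\mathcal A_{\max}$: carrier $\{a\in\mathbb N\mid a\ge w_0\}$, usual $\ge,>$, $f_{\mathcal A}(a_1..a_n)=\max(w(f),\max_i(p(f,i)+a_i))$. $s\ge_{\mathcal A}t$ (resp. $>_{\mathcal A}$) iff $\hat\alpha(s)\ge\hat\alpha(t)$ (resp. $>$) for all assignments $\alpha$. WPO for an algebra $\mathcal A$: no variable is greater than any term; $s=f(s_1..s_n)\succ_{\mathrm{WPO}(\mathcal A)}t$ iff (1) $s>_{\mathcal A}t$, or (2) $s\ge_{\mathcal A}t$ and either (a) $s_i\succeq_{\mathrm{WPO}(\mathcal A)}t$ for some $i$, or (b) $t=g(t_1..t_m)$, $s\succ_{\mathrm{WPO}(\mathcal A)}t_j$ for all $j$, and $f\succ g$, or $f\sim g$ and $\sigma(f)(s_1..s_n)\succ_{\mathrm{WPO}(\mathcal A)}^{\mathrm{lex}}\sigma(g)(t_1..t_m)$. -}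

module Defs where

open import Data.Nat using (ℕ; zero; suc; _+_; _≤_; _<_; _⊔_)
open import Data.Fin using (Fin; zero; suc)
open import Data.Fin.Permutation using (Permutation′; _⟨$⟩ʳ_)
open import Data.Vec using (Vec; []; _∷_; lookup; tabulate; toList)
open import Data.List using (List; []; _∷_)
open import Data.Product using (_×_; Σ)
open import Data.Sum using (_⊎_)
open import Relation.Nullary using (¬_)
open import Relation.Binary.PropositionalEquality using (_≡_)
open import Induction.WellFounded using (WellFounded)

data Term {k : ℕ} (ar : Fin k → ℕ) : Set where
  var : ℕ → Term ar
  fun : (f : Fin k) → Vec (Term ar) (ar f) → Term ar

record QuasiPrecedence (k : ℕ) : Set₁ where
  field
    _≿_   : Fin k → Fin k → Set
    ≿-refl  : ∀ f → f ≿ f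
    ≿-trans : ∀ {f g h} → f ≿ g → g ≿ h → f ≿ h
  _≻_ : Fin k → Fin k → Set
  f ≻ g = (f ≿ g) × ¬ (g ≿ f)
  _∼_ : Fin k → Fin k → Set
  f ∼ g = (f ≿ g) × (g ≿ f)
  field
    ≻-wf : WellFounded _≻_

Status : {k : ℕ} → (Fin k → ℕ) → Set
Status ar = ∀ f → Permutation′ (ar f)

applyStatus : ∀ {k} {ar : Fin k → ℕ} → Status ar → (f : Fin k) →
              Vec (Term ar) (ar f) → List (Term ar)
applyStatus σ f ss = toList (tabulate (λ j → lookup ss (σ f ⟨$⟩ʳ j)))

data Lex {A : Set} (R : A → A → Set) : List A → List A → Set where
  lex-nil  : ∀ {s ss} → Lex R (s ∷ ss) []
  lex-here : ∀ {s ss t ts} → R s t → Lex R (s ∷ ss) (t ∷ ts)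
  lex-next : ∀ {s ss t ts} → (s ≡ t ⊎ R s t) → Lex R ss ts → Lex R (s ∷ ss) (t ∷ ts)

module _ {k : ℕ} {ar : Fin k → ℕ} (Q : QuasiPrecedence k) (σ : Status ar) where
  open QuasiPrecedence Q

  data _>LPO_ : Term ar → Term ar → Set where
    lpo-sub  : ∀ {f ss t} (i : Fin (ar f)) →
               (lookup ss i ≡ t ⊎ lookup ss i >LPO t) → fun f ss >LPO t
    lpo-prec : ∀ {f ss g ts} → (∀ j → fun f ss >LPO lookup ts j) →
               f ≻ g → fun f ss >LPO fun g ts
    lpo-lex  : ∀ {f ss g ts} → (∀ j → fun f ss >LPO lookup ts j) →
               f ∼ g → Lex _>LPO_ (applyStatus σ f ss) (applyStatus σ g ts) →
               fun f ss >LPO fun g ts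

  LPO : Term ar → Term ar → Set
  LPO = _>LPO_

  module _ (_≥A_ _>A_ : Term ar → Term ar → Set) where
    data _>WPO_ : Term ar → Term ar → Set where
      wpo-alg  : ∀ {f ss t} → fun f ss >A t → fun f ss >WPO t
      wpo-sub  : ∀ {f ss t} → fun f ss ≥A t → (i : Fin (ar f)) →
                 (lookup ss i ≡ t ⊎ lookup ss i >WPO t) → fun f ss >WPO t
      wpo-prec : ∀ {f ss g ts} → fun f ss ≥A fun g ts →
                 (∀ j → fun f ss >WPO lookup ts j) →
                 f ≻ g → fun f ss >WPO fun g ts
      wpo-lex  : ∀ {f ss g ts} → fun f ss ≥A fun g ts →
                 (∀ j → fun f ss >WPO lookup ts j) →
                 f ∼ g → Lex _>WPO_ (applyStatus σ f ss) (applyStatus σ g ts) →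
                 fun f ss >WPO fun g ts

  WPO : (Term ar → Term ar → Set) → (Term ar → Term ar → Set) →
        Term ar → Term ar → Set
  WPO GeA GtA = _>WPO_ GeA GtA

record WeightFunction {k : ℕ} (ar : Fin k → ℕ) : Set where
  field
    w  : Fin k → ℕ
    w₀ : ℕ
    w-const : ∀ f → ar f ≡ 0 → w₀ ≤ w f

Penalty : {k : ℕ} → (Fin k → ℕ) → Set
Penalty {k} ar = (f : Fin k) → Fin (ar f) → ℕ

-- The algebra A_max: carrier {a ∈ ℕ | a ≥ w0},
-- f_A(a_1..a_n) = max(w(f), max_i (p(f,i) + a_i)).
-- An assignment is α : ℕ → ℕ together with a proof that all values are ≥ w0.
module _ {k : ℕ} {ar : Fin k → ℕ} (W : WeightFunction ar) (p : Penalty ar) where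
  open WeightFunction W

  Assignment : Set
  Assignment = Σ (ℕ → ℕ) (λ α → ∀ x → w₀ ≤ α x)

  mutual
    evalMax : (ℕ → ℕ) → Term ar → ℕ
    evalMax α (var x)    = α x
    evalMax α (fun f ts) = w f ⊔ evalArgs α (p f) ts

    -- max_i (pf i + a_i), with the empty maximum absorbed by w(f) above
    evalArgs : ∀ {n} → (ℕ → ℕ) → (Fin n → ℕ) → Vec (Term ar) n → ℕ
    evalArgs α pf []       = 0
    evalArgs α pf (t ∷ ts) = (pf zero + evalMax α t) ⊔ evalArgs α (λ i → pf (suc i)) ts

  _≥Amax_ : Term ar → Term ar → Set
  s ≥Amax t = ∀ (α : Assignment) → evalMax (Σ.proj₁ α) t ≤ evalMax (Σ.proj₁ α) s

  _>Amax_ : Term ar → Term ar → Set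
  s >Amax t = ∀ (α : Assignment) → evalMax (Σ.proj₁ α) t < evalMax (Σ.proj₁ α) s

module Submission where

-- With zero weights, zero penalties and w₀ = 0, every term evaluates to the
-- maximum of the values of its variables (or 0).  Hence under the all-zero
-- assignment every term is 0, so >_A is empty and WPO clause (1) never fires;
-- and the interpretation of a term is bounded by that of any term bigger in
-- LPO, so the side condition s ≥_A t of clause (2) always holds.  The two
-- orders are then built by the same remaining clauses.

open import Defs
open import Data.Nat using (ℕ; _+_; _≤_; _⊔_; z≤n)
open import Data.Nat.Properties
  using (≤-trans; ≤-refl; ≤-reflexive; m≤n+m; m≤m⊔n; m≤n⊔m; ⊔-lub; n≮0)
open import Data.Fin using (Fin; zero; suc)
open import Data.Vec using (Vec; []; _∷_; lookup)
open import Data.List using (List)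
open import Data.Product using (_,_)
open import Data.Sum using (inj₁; inj₂)
open import Data.Empty using (⊥-elim)
open import Relation.Nullary using (¬_)
open import Relation.Binary.PropositionalEquality using (_≡_; sym; subst)
open import Function.Bundles using (_⇔_; mk⇔)

module LPO⊆WPO {k : ℕ} {ar : Fin k → ℕ} (Q : QuasiPrecedence k) (σ : Status ar)
    (_≥A_ _>A_ : Term ar → Term ar → Set)
    (LPO⇒≥A : ∀ {s t} → LPO Q σ s t → s ≥A t) where

  mutual
    LPO⇒WPO : ∀ {s t} → LPO Q σ s t → WPO Q σ _≥A_ _>A_ s t
    LPO⇒WPO s>t@(lpo-sub i (inj₁ sᵢ≡t))  = wpo-sub (LPO⇒≥A s>t) i (inj₁ sᵢ≡t)
    LPO⇒WPO s>t@(lpo-sub i (inj₂ sᵢ>t))  = wpo-sub (LPO⇒≥A s>t) i (inj₂ (LPO⇒WPO sᵢ>t))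
    LPO⇒WPO s>t@(lpo-prec s>tⱼ f≻g)      =
      wpo-prec (LPO⇒≥A s>t) (λ j → LPO⇒WPO (s>tⱼ j)) f≻g
    LPO⇒WPO s>t@(lpo-lex s>tⱼ f∼g ss>ts) =
      wpo-lex (LPO⇒≥A s>t) (λ j → LPO⇒WPO (s>tⱼ j)) f∼g (Lex-LPO⇒Lex-WPO ss>ts)

    Lex-LPO⇒Lex-WPO : ∀ {ss ts : List (Term ar)} →
                      Lex (LPO Q σ) ss ts → Lex (WPO Q σ _≥A_ _>A_) ss ts
    Lex-LPO⇒Lex-WPO lex-nil                 = lex-nil
    Lex-LPO⇒Lex-WPO (lex-here s>t)          = lex-here (LPO⇒WPO s>t)
    Lex-LPO⇒Lex-WPO (lex-next (inj₁ s≡t) l) = lex-next (inj₁ s≡t) (Lex-LPO⇒Lex-WPO l)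
    Lex-LPO⇒Lex-WPO (lex-next (inj₂ s>t) l) = lex-next (inj₂ (LPO⇒WPO s>t)) (Lex-LPO⇒Lex-WPO l)

module WPO⊆LPO {k : ℕ} {ar : Fin k → ℕ} (Q : QuasiPrecedence k) (σ : Status ar)
    (_≥A_ _>A_ : Term ar → Term ar → Set)
    (>A-empty : ∀ s t → ¬ (s >A t)) where

  mutual
    WPO⇒LPO : ∀ {s t} → WPO Q σ _≥A_ _>A_ s t → LPO Q σ s t
    WPO⇒LPO (wpo-alg {f} {ss} {t} s>At) = ⊥-elim (>A-empty (fun f ss) t s>At)
    WPO⇒LPO (wpo-sub _ i (inj₁ sᵢ≡t))   = lpo-sub i (inj₁ sᵢ≡t)
    WPO⇒LPO (wpo-sub _ i (inj₂ sᵢ>t))   = lpo-sub i (inj₂ (WPO⇒LPO sᵢ>t))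
    WPO⇒LPO (wpo-prec _ s>tⱼ f≻g)       = lpo-prec (λ j → WPO⇒LPO (s>tⱼ j)) f≻g
    WPO⇒LPO (wpo-lex _ s>tⱼ f∼g ss>ts)  =
      lpo-lex (λ j → WPO⇒LPO (s>tⱼ j)) f∼g (Lex-WPO⇒Lex-LPO ss>ts)

    Lex-WPO⇒Lex-LPO : ∀ {ss ts : List (Term ar)} →
                      Lex (WPO Q σ _≥A_ _>A_) ss ts → Lex (LPO Q σ) ss ts
    Lex-WPO⇒Lex-LPO lex-nil                 = lex-nil
    Lex-WPO⇒Lex-LPO (lex-here s>t)          = lex-here (WPO⇒LPO s>t)
    Lex-WPO⇒Lex-LPO (lex-next (inj₁ s≡t) l) = lex-next (inj₁ s≡t) (Lex-WPO⇒Lex-LPO l)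
    Lex-WPO⇒Lex-LPO (lex-next (inj₂ s>t) l) = lex-next (inj₂ (WPO⇒LPO s>t)) (Lex-WPO⇒Lex-LPO l)

module _ {k : ℕ} {ar : Fin k → ℕ} (W : WeightFunction ar) (p : Penalty ar) where
  open WeightFunction W

  evalArgs-lookup : ∀ {n} α (pf : Fin n → ℕ) (ts : Vec (Term ar) n) i →
                    pf i + evalMax W p α (lookup ts i) ≤ evalArgs W p α pf ts
  evalArgs-lookup α pf (t ∷ ts) zero    = m≤m⊔n _ _
  evalArgs-lookup α pf (t ∷ ts) (suc i) =
    ≤-trans (evalArgs-lookup α (λ j → pf (suc j)) ts i) (m≤n⊔m _ _)

  evalArgs-lub : ∀ {n} α (pf : Fin n → ℕ) (ts : Vec (Term ar) n) {m} →
                 (∀ i → pf i + evalMax W p α (lookup ts i) ≤ m) → evalArgs W p α pf ts ≤ m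
  evalArgs-lub α pf []       bound = z≤n
  evalArgs-lub α pf (t ∷ ts) bound =
    ⊔-lub (bound zero) (evalArgs-lub α (λ i → pf (suc i)) ts (λ i → bound (suc i)))

  evalMax-subterm : ∀ α f (ss : Vec (Term ar) (ar f)) i →
                    evalMax W p α (lookup ss i) ≤ evalMax W p α (fun f ss)
  evalMax-subterm α f ss i =
    ≤-trans (m≤n+m _ (p f i)) (≤-trans (evalArgs-lookup α (p f) ss i) (m≤n⊔m (w f) _))

  module ZeroWeights (w≡0 : ∀ f → w f ≡ 0) (p≡0 : ∀ f i → p f i ≡ 0) where

    evalMax-fun-lub : ∀ α g (ts : Vec (Term ar) (ar g)) {m} →
                      (∀ j → evalMax W p α (lookup ts j) ≤ m) → evalMax W p α (fun g ts) ≤ m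
    evalMax-fun-lub α g ts {m} bound =
      ⊔-lub (subst (_≤ m) (sym (w≡0 g)) z≤n)
            (evalArgs-lub α (p g) ts (λ j → subst (λ c → c + evalMax W p α (lookup ts j) ≤ m)
                                             (sym (p≡0 g j)) (bound j)))

    mutual
      evalMax-zeroAssignment : ∀ t → evalMax W p (λ _ → 0) t ≤ 0
      evalMax-zeroAssignment (var x)    = ≤-refl
      evalMax-zeroAssignment (fun f ts) =
        ⊔-lub (≤-reflexive (w≡0 f)) (evalArgs-zeroAssignment (p f) (p≡0 f) ts)

      evalArgs-zeroAssignment : ∀ {n} (pf : Fin n → ℕ) → (∀ i → pf i ≡ 0) →
                                (ts : Vec (Term ar) n) → evalArgs W p (λ _ → 0) pf ts ≤ 0
      evalArgs-zeroAssignment pf pf≡0 []       = z≤n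
      evalArgs-zeroAssignment pf pf≡0 (t ∷ ts) =
        ⊔-lub (subst (λ c → c + _ ≤ 0) (sym (pf≡0 zero)) (evalMax-zeroAssignment t))
              (evalArgs-zeroAssignment (λ i → pf (suc i)) (λ i → pf≡0 (suc i)) ts)

    >Amax-empty : w₀ ≡ 0 → ∀ s t → ¬ (_>Amax_ W p s t)
    >Amax-empty w₀≡0 s t s>t =
      n≮0 (≤-trans (s>t ((λ _ → 0) , λ _ → ≤-reflexive w₀≡0)) (evalMax-zeroAssignment s))

    module _ (Q : QuasiPrecedence k) (σ : Status ar) where

      LPO⇒evalMax-≥ : ∀ {s t} → LPO Q σ s t → ∀ α → evalMax W p α t ≤ evalMax W p α s
      LPO⇒evalMax-≥ (lpo-sub {f} {ss} i (inj₁ sᵢ≡t)) α =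
        subst (λ t → evalMax W p α t ≤ _) sᵢ≡t (evalMax-subterm α f ss i)
      LPO⇒evalMax-≥ (lpo-sub {f} {ss} i (inj₂ sᵢ>t)) α =
        ≤-trans (LPO⇒evalMax-≥ sᵢ>t α) (evalMax-subterm α f ss i)
      LPO⇒evalMax-≥ (lpo-prec {g = g} {ts} s>tⱼ _) α =
        evalMax-fun-lub α g ts (λ j → LPO⇒evalMax-≥ (s>tⱼ j) α)
      LPO⇒evalMax-≥ (lpo-lex {g = g} {ts} s>tⱼ _ _) α =
        evalMax-fun-lub α g ts (λ j → LPO⇒evalMax-≥ (s>tⱼ j) α)

      LPO⇒≥Amax : ∀ {s t} → LPO Q σ s t → _≥Amax_ W p s t
      LPO⇒≥Amax s>t (α , _) = LPO⇒evalMax-≥ s>t α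

theorem19 : ∀ {k : ℕ} (ar : Fin k → ℕ) (Q : QuasiPrecedence k) (σ : Status ar)
              (W : WeightFunction ar) (p : Penalty ar) →
              WeightFunction.w₀ W ≡ 0 →
              (∀ f → WeightFunction.w W f ≡ 0) →
              (∀ f i → p f i ≡ 0) →
              ∀ (s t : Term ar) →
              (LPO Q σ s t ⇔ WPO Q σ (_≥Amax_ W p) (_>Amax_ W p) s t)
theorem19 ar Q σ W p w₀≡0 w≡0 p≡0 s t =
  mk⇔ (LPO⊆WPO.LPO⇒WPO Q σ (_≥Amax_ W p) (_>Amax_ W p) (Amax.LPO⇒≥Amax Q σ))
      (WPO⊆LPO.WPO⇒LPO Q σ (_≥Amax_ W p) (_>Amax_ W p) (Amax.>Amax-empty w₀≡0))
  where module Amax = ZeroWeights W p w≡0 p≡0
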